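{- For all $h \in \mathbb{N}$, the word $\varphi(h)$ starts with the letter $h$ and ends with the letter $h+1$. Furthermore, if $w \in \{0,\ldots,h\}^*$, then the number of occurrences of the letter $h+1$ in $\varphi(w)$ equals the number of occurrences of the letter $h$ in $w$, and each occurrence of $h+1$ in $\varphi(w)$ is immediately preceded by the letter $0$.
   Context: $\mathbb{N}=\{0,1,2,\ldots\}$ is an alphabet; $x\cdot y$ denotes concatenation. $S$ is the left cyclic shift, $S(cx) = xc$ for a letter $c$ and word $x$, and $S^{ -1}$ is its inverse (right cyclic shift, $S^{ -1}(xc) = cx$). For each $h\in\mathbb{N}$ define the morphism $\varphi_h \colon \{0,\ldots,h\}^* \to \{0,\ldots,h+1\}^*$ recursively by $\varphi_h(h') = \varphi_{h'}(h')$ for $h'<h$ and $\varphi_h(h) = \big(S^{ -1}(\varphi_{h-1}\circ\cdots\circ\varphi_0(00))\big)\cdot(h+1)$ (so $\varphi_0(0) = S^{ -1}(00)\cdot 1 = 001$). Since $\varphi_h$ extends $\varphi_{h'}$ for $h'<h$, let $\varphi\colon\mathbb{N}^*\to\mathbb{N}^*$ be their common extension; thus $\varphi(h) = S^{ -1}(\varphi^h(00))\cdot(h+1)$, e.g. $\varphi(0)=001$, $\varphi(1)=1001002$, $\varphi(2)=200100110010020010011001003$. -}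

module Defs where

open import Data.Nat using (ℕ; zero; suc; _≟_)
open import Data.List using (List; []; _∷_; _++_; [_]; concatMap; length; filter)
open import Data.Maybe using (Maybe; just; nothing)
open import Relation.Binary.PropositionalEquality using (_≡_; refl)

rotR : List ℕ → List ℕ
rotR []       = []
rotR (x ∷ xs) with rotR xs
... | []       = x ∷ []
... | (c ∷ ys) = c ∷ x ∷ ys

iter : {A : Set} → ℕ → (A → A) → A → A
iter zero    f a = a
iter (suc n) f a = f (iter n f a)

-- i-th element of a list of words (default [] out of range; never reached below)
nth : List (List ℕ) → ℕ → List ℕ
nth []       _       = []
nth (x ∷ _)  zero    = x
nth (_ ∷ xs) (suc i) = nth xs i

applyTab : List (List ℕ) → List ℕ → List ℕ
applyTab t = concatMap (nth t)

-- tab h = [φ(0), …, φ(h-1)].  φ(h) = S⁻¹(φ^h(00))·(h+1), where φ^h(00) only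
-- involves letters < h at each application step, so only tab h is needed.
tab : ℕ → List (List ℕ)
tab zero    = []
tab (suc h) = tab h ++ [ rotR (iter h (applyTab (tab h)) (0 ∷ 0 ∷ [])) ++ [ suc h ] ]

φ : ℕ → List ℕ
φ h = nth (tab (suc h)) h

φ* : List ℕ → List ℕ
φ* = concatMap φ

occ : ℕ → List ℕ → ℕ
occ a w = length (filter (_≟ a) w)

_ : φ 0 ≡ 0 ∷ 0 ∷ 1 ∷ []
_ = refl
_ : φ 1 ≡ 1 ∷ 0 ∷ 0 ∷ 1 ∷ 0 ∷ 0 ∷ 2 ∷ []
_ = refl
_ : φ 2 ≡ 2 ∷ 0 ∷ 0 ∷ 1 ∷ 0 ∷ 0 ∷ 1 ∷ 1 ∷ 0 ∷ 0 ∷ 1 ∷ 0 ∷ 0 ∷ 2 ∷ 0 ∷ 0 ∷ 1 ∷ 0 ∷ 0 ∷ 1 ∷ 1 ∷ 0 ∷ 0 ∷ 1 ∷ 0 ∷ 0 ∷ 3 ∷ []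
_ = refl

-- Since φ(h) = S⁻¹(φ^h(00))·(h+1), everything follows from the shape
-- φ(h) = h·Z·0·(h+1) with Z ∈ {0,…,h}*. It is proved by strong induction on h together
-- with φ^j(00) = Z′·0·j for some Z′ ∈ {0,…,j}*: applying φ to Z′·0·j gives
-- φ(Z′·0)·j·Z_j·0·(j+1), and rotating φ^h(00) = Z′·0·h right yields h·Z′·0.
-- Hence for w ∈ {0,…,h}* the letter h+1 occurs in φ(w) only as the last letter of a
-- block φ(h), right after a 0.
module Submission where

open import Defs
open import Data.Nat using (ℕ; zero; suc; _≤_; _<_; z≤n; s≤s; _≟_; _+_)
open import Data.Nat.Induction using (<-rec)
open import Data.Nat.Properties
  using (≤-refl; ≤-trans; <-trans; ≤-<-trans; n≤1+n; n<1+n; m≤n⇒m≤1+n; m<n⇒m<1+n; m<1+n⇒m<n∨m≡n; <⇒≢; 1+n≰n; suc-injective; +-comm)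
open import Data.List using (List; []; _∷_; _++_; [_]; head; last; length; filter)
open import Data.List.Properties
  using (++-assoc; ++-identityʳ; length-++; filter-++; filter-accept; filter-reject; filter-none; concatMap-++)
open import Data.List.Relation.Unary.All using (All; []; _∷_)
import Data.List.Relation.Unary.All as All
open import Data.List.Relation.Unary.All.Properties using (++⁺)
open import Data.List.Relation.Unary.Linked using (Linked; []; [-]; _∷_)
import Data.List.Relation.Unary.Linked.Properties as Linked
open import Data.Maybe using (just; nothing)
import Data.Maybe.Relation.Unary.All as Maybe
open import Data.Maybe.Relation.Binary.Connected using (Connected; just; just-nothing; nothing-just; nothing)
open import Data.Product using (_×_; ∃; _,_)
open import Data.Sum using (_⊎_; inj₁; inj₂)
open import Relation.Nullary using (yes; no; contradiction)
open import Relation.Binary.PropositionalEquality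
  using (_≡_; _≢_; refl; sym; trans; cong; cong₂; subst; module ≡-Reasoning)
open ≡-Reasoning

nth-++ˡ : ∀ xs ys {i} → i < length xs → nth (xs ++ ys) i ≡ nth xs i
nth-++ˡ (x ∷ xs) ys {zero}  _         = refl
nth-++ˡ (x ∷ xs) ys {suc i} (s≤s i<n) = nth-++ˡ xs ys i<n

nth-++-length : ∀ xs y ys → nth (xs ++ y ∷ ys) (length xs) ≡ y
nth-++-length []       y ys = refl
nth-++-length (x ∷ xs) y ys = nth-++-length xs y ys

length-tab : ∀ h → length (tab h) ≡ h
length-tab zero    = refl
length-tab (suc h) = begin
  length (tab h ++ _)  ≡⟨ length-++ (tab h) ⟩
  length (tab h) + 1   ≡⟨ +-comm (length (tab h)) 1 ⟩
  suc (length (tab h)) ≡⟨ cong suc (length-tab h) ⟩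
  suc h                ∎

nth-tab : ∀ {h i} → i < h → nth (tab h) i ≡ φ i
nth-tab {suc h} {i} i<1+h with m<1+n⇒m<n∨m≡n i<1+h
... | inj₂ refl = refl
... | inj₁ i<h  = trans (nth-++ˡ (tab h) _ (subst (i <_) (sym (length-tab h)) i<h)) (nth-tab i<h)

applyTab-tab : ∀ {h} w → All (_< h) w → applyTab (tab h) w ≡ φ* w
applyTab-tab []      []          = refl
applyTab-tab (a ∷ w) (a<h ∷ w<h) = cong₂ _++_ (nth-tab a<h) (applyTab-tab w w<h)

φ-unfold : ∀ h → φ h ≡ rotR (iter h (applyTab (tab h)) (0 ∷ 0 ∷ [])) ++ [ suc h ]
φ-unfold h = trans (cong (nth (tab (suc h))) (sym (length-tab h))) (nth-++-length (tab h) _ [])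

rotR-∷ʳ : ∀ xs c → rotR (xs ++ [ c ]) ≡ c ∷ xs
rotR-∷ʳ []       c = refl
rotR-∷ʳ (x ∷ xs) c rewrite rotR-∷ʳ xs c = refl

iter-cong : ∀ {A : Set} (f g : A → A) x j →
            (∀ {i} → i < j → f (iter i g x) ≡ g (iter i g x)) →
            iter j f x ≡ iter j g x
iter-cong f g x zero    _  = refl
iter-cong f g x (suc j) fg = begin
  f (iter j f x) ≡⟨ cong f (iter-cong f g x j (λ i<j → fg (m<n⇒m<1+n i<j))) ⟩
  f (iter j g x) ≡⟨ fg ≤-refl ⟩
  g (iter j g x) ∎

Shape : ℕ → Set
Shape a = ∃ λ Z → All (_≤ a) Z × φ a ≡ a ∷ Z ++ 0 ∷ suc a ∷ []

IterateShape : ℕ → Set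
IterateShape j = ∃ λ Z → All (_≤ j) Z × iter j φ* (0 ∷ 0 ∷ []) ≡ Z ++ 0 ∷ j ∷ []

φ-bounded : ∀ {a} → Shape a → All (_≤ suc a) (φ a)
φ-bounded {a} (Z , Z≤a , eq) rewrite eq =
  n≤1+n a ∷ ++⁺ (All.map m≤n⇒m≤1+n Z≤a) (z≤n ∷ ≤-refl ∷ [])

φ*-bounded : ∀ {j} → (∀ {a} → a ≤ j → Shape a) → ∀ {w} → All (_≤ j) w → All (_≤ suc j) (φ* w)
φ*-bounded shape []          = []
φ*-bounded shape (a≤j ∷ w≤j) =
  ++⁺ (All.map (λ x≤1+a → ≤-trans x≤1+a (s≤s a≤j)) (φ-bounded (shape a≤j))) (φ*-bounded shape w≤j)

iterate-shape : ∀ j → (∀ {i} → i < j → Shape i) → IterateShape j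
iterate-shape zero    _      = [] , [] , refl
iterate-shape (suc j) shape<
  with (Z , Z≤j , eq)     ← iterate-shape j (λ i<j → shape< (m<n⇒m<1+n i<j))
     | (Zⱼ , Zⱼ≤j , eqⱼ) ← shape< (n<1+n j)
  = Z′ ++ j ∷ Zⱼ
  , ++⁺ (φ*-bounded (λ a≤j → shape< (s≤s a≤j)) (++⁺ Z≤j (z≤n ∷ []))) (n≤1+n j ∷ All.map m≤n⇒m≤1+n Zⱼ≤j)
  , (begin
    φ* (iter j φ* (0 ∷ 0 ∷ []))            ≡⟨ cong φ* (trans eq (sym (++-assoc Z [ 0 ] [ j ]))) ⟩
    φ* ((Z ++ [ 0 ]) ++ [ j ])             ≡⟨ concatMap-++ φ (Z ++ [ 0 ]) [ j ] ⟩
    Z′ ++ φ j ++ []                        ≡⟨ cong (Z′ ++_) (trans (++-identityʳ (φ j)) eqⱼ) ⟩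
    Z′ ++ j ∷ Zⱼ ++ 0 ∷ suc j ∷ []         ≡⟨ sym (++-assoc Z′ (j ∷ Zⱼ) _) ⟩
    (Z′ ++ j ∷ Zⱼ) ++ 0 ∷ suc j ∷ []       ∎)
  where Z′ = φ* (Z ++ [ 0 ])

iterate-applyTab : ∀ h → (∀ {i} → i < h → Shape i) →
                   iter h (applyTab (tab h)) (0 ∷ 0 ∷ []) ≡ iter h φ* (0 ∷ 0 ∷ [])
iterate-applyTab h shape< = iter-cong _ _ _ h agree
  where
  agree : ∀ {i} → i < h → applyTab (tab h) (iter i φ* (0 ∷ 0 ∷ [])) ≡ φ* (iter i φ* (0 ∷ 0 ∷ []))
  agree {i} i<h with (Z , Z≤i , eq) ← iterate-shape i (λ k<i → shape< (<-trans k<i i<h)) =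
    applyTab-tab _ (subst (All (_< h)) (sym eq)
      (All.map (λ x≤i → ≤-<-trans x≤i i<h) (++⁺ Z≤i (z≤n ∷ ≤-refl ∷ []))))

shape-step : ∀ h → (∀ {i} → i < h → Shape i) → Shape h
shape-step h shape< with (Z , Z≤h , eq) ← iterate-shape h shape< = Z , Z≤h , (begin
  φ h                                             ≡⟨ φ-unfold h ⟩
  rotR (iter h (applyTab (tab h)) _) ++ [ suc h ] ≡⟨ cong (λ xs → rotR xs ++ [ suc h ]) Zh ⟩
  rotR ((Z ++ [ 0 ]) ++ [ h ]) ++ [ suc h ]       ≡⟨ cong (_++ [ suc h ]) (rotR-∷ʳ (Z ++ [ 0 ]) h) ⟩
  h ∷ (Z ++ [ 0 ]) ++ [ suc h ]                   ≡⟨ cong (h ∷_) (++-assoc Z [ 0 ] [ suc h ]) ⟩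
  h ∷ Z ++ 0 ∷ suc h ∷ []                         ∎)
  where
  Zh : iter h (applyTab (tab h)) (0 ∷ 0 ∷ []) ≡ (Z ++ [ 0 ]) ++ [ h ]
  Zh = trans (iterate-applyTab h shape<) (trans eq (sym (++-assoc Z [ 0 ] [ h ])))

-- Opaque so that `with` on φ-shape does not unfold the well-founded recursion.
opaque
  φ-shape : ∀ h → Shape h
  φ-shape = <-rec Shape shape-step

≤⇒≢1+ : ∀ {x h} → x ≤ h → x ≢ suc h
≤⇒≢1+ x≤h = <⇒≢ (s≤s x≤h)

φ-block : ∀ {h a} → a ≤ h → ∃ λ B → All (_≤ h) B × φ a ≡ B ++ 0 ∷ suc a ∷ []
φ-block {a = a} a≤h with (Z , Z≤a , eq) ← φ-shape a =
  a ∷ Z , a≤h ∷ All.map (λ x≤a → ≤-trans x≤a a≤h) Z≤a , eq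

φ*-head-bounded : ∀ {h w} → All (_≤ h) w → Maybe.All (_≤ h) (head (φ* w))
φ*-head-bounded []            = Maybe.nothing
φ*-head-bounded {w = a ∷ w} (a≤h ∷ _) with (_ , _ , eq) ← φ-shape a rewrite eq = Maybe.just a≤h

last-∷ʳ : ∀ {A : Set} (xs : List A) y → last (xs ++ [ y ]) ≡ just y
last-∷ʳ []            y = refl
last-∷ʳ (x ∷ [])      y = refl
last-∷ʳ (x ∷ x′ ∷ xs) y = last-∷ʳ (x′ ∷ xs) y

occ-++ : ∀ a xs ys → occ a (xs ++ ys) ≡ occ a xs + occ a ys
occ-++ a xs ys = trans (cong length (filter-++ (_≟ a) xs ys)) (length-++ (filter (_≟ a) xs))

occ-absent : ∀ {a xs} → All (_≢ a) xs → occ a xs ≡ 0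
occ-absent {a} xs≢a = cong length (filter-none (_≟ a) xs≢a)

occ-suc-[_] : ∀ a {h} → occ (suc h) [ suc a ] ≡ occ h [ a ]
occ-suc-[ a ] {h} with a ≟ h
... | yes refl = trans (cong length (filter-accept (_≟ suc a) refl))
                       (sym (cong length (filter-accept (_≟ a) refl)))
... | no a≢h   = trans (cong length (filter-reject (_≟ suc h) (λ eq → a≢h (suc-injective eq))))
                       (sym (cong length (filter-reject (_≟ h) a≢h)))

occ-φ : ∀ {h a} → a ≤ h → occ (suc h) (φ a) ≡ occ h [ a ]
occ-φ {h} {a} a≤h with (B , B≤h , eq) ← φ-block a≤h = begin
  occ (suc h) (φ a)                           ≡⟨ cong (occ (suc h)) eq ⟩
  occ (suc h) (B ++ 0 ∷ suc a ∷ [])           ≡⟨ occ-++ (suc h) B _ ⟩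
  occ (suc h) B + occ (suc h) [ suc a ]       ≡⟨ cong (_+ _) (occ-absent (All.map ≤⇒≢1+ B≤h)) ⟩
  occ (suc h) [ suc a ]                       ≡⟨ occ-suc-[ a ] ⟩
  occ h [ a ]                                 ∎

occ-φ* : ∀ {h w} → All (_≤ h) w → occ (suc h) (φ* w) ≡ occ h w
occ-φ* []                      = refl
occ-φ* {h} {a ∷ w} (a≤h ∷ w≤h) = begin
  occ (suc h) (φ a ++ φ* w)              ≡⟨ occ-++ (suc h) (φ a) (φ* w) ⟩
  occ (suc h) (φ a) + occ (suc h) (φ* w) ≡⟨ cong₂ _+_ (occ-φ a≤h) (occ-φ* w≤h) ⟩
  occ h [ a ] + occ h w                  ≡⟨ occ-++ h [ a ] w ⟨
  occ h (a ∷ w)                          ∎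

ZeroPrecedes : ℕ → ℕ → ℕ → Set
ZeroPrecedes b x y = y ≡ b → x ≡ 0

ZeroBefore : ℕ → List ℕ → Set
ZeroBefore b = Linked (ZeroPrecedes b)

zeroBefore-split : ∀ {b} u {v} → ZeroBefore b (u ++ b ∷ v) → u ≡ [] ⊎ ∃ λ u′ → u ≡ u′ ++ [ 0 ]
zeroBefore-split []          _             = inj₁ refl
zeroBefore-split (x ∷ [])    (x≡0 ∷ _)     = inj₂ ([] , cong [_] (x≡0 refl))
zeroBefore-split (x ∷ y ∷ u) (_ ∷ y∷u++bv) with zeroBefore-split (y ∷ u) y∷u++bv
... | inj₂ (u′ , eq) = inj₂ (x ∷ u′ , cong (x ∷_) eq)

zeroBefore-block : ∀ {h b xs} → All (_≤ h) xs → ZeroBefore (suc h) (xs ++ 0 ∷ b ∷ [])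
zeroBefore-block []               = (λ _ → refl) ∷ [-]
zeroBefore-block (_ ∷ [])         = (λ ()) ∷ (λ _ → refl) ∷ [-]
zeroBefore-block (_ ∷ y≤h ∷ xs≤h) =
  (λ y≡1+h → contradiction y≡1+h (≤⇒≢1+ y≤h)) ∷ zeroBefore-block (y≤h ∷ xs≤h)

zeroPrecedes-connected : ∀ {h} x {my} → Maybe.All (_≤ h) my → Connected (ZeroPrecedes (suc h)) x my
zeroPrecedes-connected (just _) (Maybe.just y≤h) = just (λ y≡1+h → contradiction y≡1+h (≤⇒≢1+ y≤h))
zeroPrecedes-connected (just _) Maybe.nothing    = just-nothing
zeroPrecedes-connected nothing  (Maybe.just _)   = nothing-just
zeroPrecedes-connected nothing  Maybe.nothing    = nothing

zeroBefore-φ* : ∀ {h w} → All (_≤ h) w → ZeroBefore (suc h) (φ* w)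
zeroBefore-φ* []                        = []
zeroBefore-φ* {w = a ∷ w} (a≤h ∷ w≤h) with (B , B≤h , eq) ← φ-block a≤h rewrite eq =
  Linked.++⁺ (zeroBefore-block B≤h) (zeroPrecedes-connected _ (φ*-head-bounded w≤h)) (zeroBefore-φ* w≤h)

φ*-occurrence-preceded-by-0 : ∀ {h w} → All (_≤ h) w → ∀ u v → φ* w ≡ u ++ suc h ∷ v →
                           ∃ λ u′ → u ≡ u′ ++ [ 0 ]
φ*-occurrence-preceded-by-0 {h} w≤h u v eq
  with zeroBefore-split u (subst (ZeroBefore (suc h)) eq (zeroBefore-φ* w≤h))
... | inj₂ u≡u′0 = u≡u′0
... | inj₁ refl with subst (λ xs → Maybe.All (_≤ h) (head xs)) eq (φ*-head-bounded w≤h)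
...   | Maybe.just 1+h≤h = contradiction 1+h≤h 1+n≰n

lemma4 : (h : ℕ) →
    (head (φ h) ≡ just h × last (φ h) ≡ just (suc h))
    × ((w : List ℕ) → All (_≤ h) w →
        occ (suc h) (φ* w) ≡ occ h w
        × ((u v : List ℕ) → φ* w ≡ u ++ suc h ∷ v → ∃ λ u′ → u ≡ u′ ++ [ 0 ]))
lemma4 h with (Z , _ , eq) ← φ-shape h =
  ( cong head eq
  , (begin
      last (φ h)                           ≡⟨ cong last eq ⟩
      last (h ∷ Z ++ 0 ∷ suc h ∷ [])       ≡⟨ cong last (++-assoc (h ∷ Z) [ 0 ] [ suc h ]) ⟨
      last ((h ∷ Z ++ [ 0 ]) ++ [ suc h ]) ≡⟨ last-∷ʳ (h ∷ Z ++ [ 0 ]) (suc h) ⟩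
      just (suc h)                         ∎) )
  , λ w w≤h → occ-φ* w≤h , φ*-occurrence-preceded-by-0 w≤h
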